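{- The Vámos matroid $V_8$ is not representable over any skew partial field.
   Context: A skew partial field is a pair $\mathbb{P}=(R,G)$ with $R$ a (not necessarily commutative) ring with identity and $G$ a subgroup of the units $R^*$ with $-1\in G$. An $R$-chain group on a finite set $E$ is a subset of $R^E$ containing $0$ and closed under componentwise addition and left scalar multiplication. A chain $c$ is elementary in $C$ if $c\ne0$ and no nonzero chain of $C$ has support strictly contained in $\|c\|=\{e:c_e\ne0\}$; $c$ is $G$-primitive if its entries lie in $G\cup\{0\}$. A $\mathbb{P}$-chain group is an $R$-chain group in which every elementary chain equals $rc'$ with $r\in R$, $c'$ a $G$-primitive chain of the group; $M(C)$ is the matroid on $E$ whose cocircuits are the supports of the elementary chains of $C$. A matroid $M$ is representable over $\mathbb{P}$ if $M=M(C)$ for some $\mathbb{P}$-chain group $C$. The Vámos matroid $V_8$ is the rank-4 matroid on $\{1,\dots,8\}$ in which every set of at most 3 elements is independent and the 4-element dependent sets (circuits) are exactly $\{1,2,5,6\},\{1,2,7,8\},\{3,4,5,6\},\{3,4,7,8\},\{5,6,7,8\}$; all other 4-element sets (in particular $\{1,2,3,4\}$) are bases. -}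

module Defs where

open import Level using (Level; _⊔_)
open import Algebra.Bundles using (Ring)
open import Data.Nat using (ℕ)
open import Data.Fin using (Fin)
open import Data.Fin.Subset using (Subset; Side; inside; outside; _∈_; _⊆_; _⊂_; ∁; ∣_∣)
open import Data.Vec using (_∷_; [])
open import Data.List using (List; _∷_; [])
open import Data.List.Membership.Propositional using (_∉_)
open import Data.Product using (Σ; ∃; _×_; _,_)
open import Data.Sum using (_⊎_)
open import Relation.Nullary using (¬_)
open import Relation.Binary.PropositionalEquality using (_≡_)

module _ {c ℓ : Level} (R : Ring c ℓ) where
  open Ring R

  IsUnit : Carrier → Set (c ⊔ ℓ)
  IsUnit u = ∃ λ v → (u * v ≈ 1#) × (v * u ≈ 1#)

  record IsSkewPartialField {g : Level} (G : Carrier → Set g) : Set (c ⊔ ℓ ⊔ g) where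
    field
      G-resp     : ∀ {x y} → x ≈ y → G x → G y
      G-unit     : ∀ {x} → G x → IsUnit x
      G-one      : G 1#
      G-mul      : ∀ {x y} → G x → G y → G (x * y)
      G-inv      : ∀ {x y} → G x → x * y ≈ 1# → y * x ≈ 1# → G y
      G-minusOne : G (- 1#)

  Chain : ℕ → Set c
  Chain n = Fin n → Carrier

  record IsChainGroup {k : Level} {n : ℕ} (C : Chain n → Set k) : Set (c ⊔ ℓ ⊔ k) where
    field
      C-resp : ∀ {x y} → (∀ e → x e ≈ y e) → C x → C y
      C-zero : C (λ _ → 0#)
      C-add  : ∀ {x y} → C x → C y → C (λ e → x e + y e)
      C-smul : ∀ {x} (r : Carrier) → C x → C (λ e → r * x e)

  InSupp : {n : ℕ} → Chain n → Fin n → Set ℓ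
  InSupp x e = ¬ (x e ≈ 0#)

  NonZeroChain : {n : ℕ} → Chain n → Set ℓ
  NonZeroChain x = ¬ (∀ e → x e ≈ 0#)

  SuppStrictSub : {n : ℕ} → Chain n → Chain n → Set ℓ
  SuppStrictSub d x = (∀ e → InSupp d e → InSupp x e) × ¬ (∀ e → InSupp x e → InSupp d e)

  Elementary : ∀ {k} {n : ℕ} → (Chain n → Set k) → Chain n → Set (c ⊔ ℓ ⊔ k)
  Elementary C x = C x × NonZeroChain x × (∀ d → C d → NonZeroChain d → ¬ SuppStrictSub d x)

  Primitive : ∀ {g} {n : ℕ} → (Carrier → Set g) → Chain n → Set (g ⊔ ℓ)
  Primitive G x = ∀ e → G (x e) ⊎ (x e ≈ 0#)

  IsPChainGroup : ∀ {g k} {n : ℕ} → (Carrier → Set g) → (Chain n → Set k) → Set (c ⊔ ℓ ⊔ g ⊔ k)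
  IsPChainGroup G C =
    IsChainGroup C ×
    (∀ x → Elementary C x →
       ∃ λ r → ∃ λ x′ → C x′ × Primitive G x′ × (∀ e → x e ≈ r * x′ e))

  SuppIs : {n : ℕ} → Chain n → Subset n → Set ℓ
  SuppIs x D = ∀ e → (InSupp x e → e ∈ D) × (e ∈ D → InSupp x e)

  -- M(C) = M, where M is given by its family of cocircuits Cocirc:
  -- the supports of elementary chains of C are exactly the cocircuits.
  MatroidOfIs : ∀ {k} {n : ℕ} → (Chain n → Set k) → (Subset n → Set) → Set (c ⊔ ℓ ⊔ k)
  MatroidOfIs C Cocirc =
    (∀ x → Elementary C x → ∃ λ D → Cocirc D × SuppIs x D) ×
    (∀ D → Cocirc D → ∃ λ x → Elementary C x × SuppIs x D)

-- The Vámos matroid V8 on Fin 8 (element i+1 of the paper is index i).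

private
  I O : Side
  I = inside
  O = outside

c1256 c1278 c3456 c3478 c5678 : Subset 8
c1256 = I ∷ I ∷ O ∷ O ∷ I ∷ I ∷ O ∷ O ∷ []
c1278 = I ∷ I ∷ O ∷ O ∷ O ∷ O ∷ I ∷ I ∷ []
c3456 = O ∷ O ∷ I ∷ I ∷ I ∷ I ∷ O ∷ O ∷ []
c3478 = O ∷ O ∷ I ∷ I ∷ O ∷ O ∷ I ∷ I ∷ []
c5678 = O ∷ O ∷ O ∷ O ∷ I ∷ I ∷ I ∷ I ∷ []

vamosFourCircuits : List (Subset 8)
vamosFourCircuits = c1256 ∷ c1278 ∷ c3456 ∷ c3478 ∷ c5678 ∷ []

VamosBasis : Subset 8 → Set
VamosBasis B = (∣ B ∣ ≡ 4) × (B ∉ vamosFourCircuits)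

VamosDualBasis : Subset 8 → Set
VamosDualBasis B* = ∃ λ B → VamosBasis B × (B* ≡ ∁ B)

VamosDualDependent : Subset 8 → Set
VamosDualDependent D = ¬ (∃ λ B* → VamosDualBasis B* × D ⊆ B*)

-- cocircuits of V8 = circuits of V8* = minimal dependent sets of V8*
VamosCocircuit : Subset 8 → Set
VamosCocircuit D = VamosDualDependent D × (∀ D′ → D′ ⊂ D → ¬ VamosDualDependent D′)

-- Suppose V₈ = M(C) for a (R , G)-chain group C.  Every cocircuit D of V₈ is then the
-- support of a chain of C whose entries on D are units, and a chain of C whose support
-- lies strictly inside a cocircuit is zero.  Take such unit chains t, w, y, w′, y′ on the
-- cocircuits {1,2,3,4}, {1,2,7,8}, {3,4,7,8}, {1,2,5,6}, {3,4,5,6}.  Eliminating the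
-- coordinates 1 and 3 of t with w, y (resp. w′, y′) leaves a chain supported in
-- {2,4,7,8} (resp. {2,4,5,6}), strictly inside the cocircuit {2,4,6,7,8} (resp.
-- {2,4,5,6,8}), hence zero.  With m = t₁ w₁⁻¹ and m′ = t₁ w′₁⁻¹ this says that m w and
-- m′ w′ agree on the coordinates 1 and 2, so m w − m′ w′ is supported in {5,6,7,8},
-- strictly inside the cocircuit {1,5,6,7,8}, hence zero.  Its coordinate 7 is m w₇, so
-- m = 0 and t₁ = m w₁ = 0, contradicting that t₁ is a unit.
module Submission where

open import Defs
open import Level using (Level; _⊔_)
open import Algebra.Bundles using (Ring)
open import Data.Nat using (ℕ; _≟_)
open import Data.Bool using () renaming (_≟_ to _≟ᵇ_)
open import Data.Fin using (Fin; #_)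
open import Data.Fin.Properties using (all?) renaming (_≟_ to _≟ᶠ_)
open import Data.Fin.Subset using (Subset; Side; inside; outside; _∈_; _∉_; _⊆_; _⊂_; ∁; ∣_∣; _∪_; _-_)
open import Data.Fin.Subset.Properties using (_∈?_; _⊆?_; _⊂?_; anySubset?; p⊆p∪q; q⊆p∪q; x∈p∧x≢y⇒x∈p-y)
open import Data.Vec using (_∷_; [])
open import Data.Vec.Properties using (≡-dec)
open import Data.List.Membership.DecPropositional (≡-dec {n = 8} _≟ᵇ_) using () renaming (_∈?_ to _∈ᴸ?_)
open import Data.Product using (∃; _×_; _,_; proj₁; proj₂)
open import Data.Sum using (inj₁; inj₂)
open import Data.Empty using (⊥; ⊥-elim)
open import Relation.Nullary using (¬_; Dec; yes; no)
open import Relation.Nullary.Decidable using (_×-dec_; ¬?; _→-dec_; True; False; toWitness; toWitnessFalse)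
open import Relation.Binary.PropositionalEquality using (refl)

∈! : ∀ {n} {e : Fin n} {D : Subset n} {e∈D : True (e ∈? D)} → e ∈ D
∈! {e∈D = e∈D} = toWitness e∈D

∉! : ∀ {n} {e : Fin n} {D : Subset n} {e∉D : False (e ∈? D)} → e ∉ D
∉! {e∉D = e∉D} = toWitnessFalse e∉D

⊂! : ∀ {n} {A D : Subset n} {A⊂D : True (A ⊂? D)} → A ⊂ D
⊂! {A⊂D = A⊂D} = toWitness A⊂D

vamosBasis? : (B : Subset 8) → Dec (VamosBasis B)
vamosBasis? B = (∣ B ∣ ≟ 4) ×-dec ¬? (B ∈ᴸ? vamosFourCircuits)

VamosCoindependent : Subset 8 → Set
VamosCoindependent D = ∃ λ B → VamosBasis B × D ⊆ ∁ B

vamosCoindependent? : (D : Subset 8) → Dec (VamosCoindependent D)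
vamosCoindependent? D = anySubset? (λ B → vamosBasis? B ×-dec (D ⊆? ∁ B))

coindependent-⊆ : ∀ {D′ D} → D′ ⊆ D → VamosCoindependent D → VamosCoindependent D′
coindependent-⊆ D′⊆D (B , basis , D⊆∁B) = B , basis , λ e∈D′ → D⊆∁B (D′⊆D e∈D′)

coindependent⇒¬dualDependent : ∀ {D} → VamosCoindependent D → ¬ VamosDualDependent D
coindependent⇒¬dualDependent (B , basis , D⊆∁B) dependent = dependent (∁ B , (B , basis , refl) , D⊆∁B)

¬coindependent⇒dualDependent : ∀ {D} → ¬ VamosCoindependent D → VamosDualDependent D
¬coindependent⇒dualDependent ¬coind (_ , (B , basis , refl) , D⊆∁B) = ¬coind (B , basis , D⊆∁B)

-- Dual dependence is upward closed, so minimality only has to be checked on D - x.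
dependent∧deletionsCoindependent⇒cocircuit : ∀ {D} → VamosDualDependent D →
  (∀ {x} → x ∈ D → VamosCoindependent (D - x)) → VamosCocircuit D
dependent∧deletionsCoindependent⇒cocircuit dependent deletions =
  dependent , λ { D′ (D′⊆D , x , x∈D , x∉D′) → coindependent⇒¬dualDependent
    (coindependent-⊆ (λ {y} y∈D′ → x∈p∧x≢y⇒x∈p-y (D′⊆D y∈D′) (λ { refl → x∉D′ y∈D′ }))
                     (deletions x∈D)) }

vamosCocircuit : (D : Subset 8) → {False (vamosCoindependent? D)} →
  {True (all? (λ x → x ∈? D →-dec vamosCoindependent? (D - x)))} → VamosCocircuit D
vamosCocircuit D {dependent} {deletions} =
  dependent∧deletionsCoindependent⇒cocircuit (¬coindependent⇒dualDependent (toWitnessFalse dependent))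
    (λ {x} → toWitness deletions x)

module ChainAlgebra {c ℓ : Level} (R : Ring c ℓ) where
  open Ring R hiding (_-_)
  open import Algebra.Properties.Ring R using (-1*x≈-x)
  open import Algebra.Properties.Group +-group using (ε⁻¹≈ε; x∙y⁻¹≈ε⇒x≈y; x≈y⇒x∙y⁻¹≈ε)
  open import Relation.Binary.Reasoning.Setoid setoid

  infixr 7 _·_
  infixl 6 _⊖_

  _·_ : ∀ {n} → Carrier → Chain R n → Chain R n
  (r · x) e = r * x e

  _⊖_ : ∀ {n} → Chain R n → Chain R n → Chain R n
  (x ⊖ y) e = x e + - y e

  eliminate : ∀ {n} → Chain R n → Chain R n → Fin n → Carrier → Chain R n
  eliminate x y e v = x ⊖ (x e * v) · y

  VanishesOff : ∀ {n} → Chain R n → Subset n → Set ℓ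
  VanishesOff x A = ∀ {e} → e ∉ A → x e ≈ 0#

  ⊖-closed : ∀ {k n} {C : Chain R n → Set k} → IsChainGroup R C →
             ∀ {x y} → C x → C y → C (x ⊖ y)
  ⊖-closed isChainGroup Cx Cy = C-add Cx (C-resp (λ e → -1*x≈-x _) (C-smul (- 1#) Cy))
    where open IsChainGroup isChainGroup

  eliminate-closed : ∀ {k n} {C : Chain R n → Set k} → IsChainGroup R C →
                     ∀ {x y} e v → C x → C y → C (eliminate x y e v)
  eliminate-closed isChainGroup {x} e v Cx Cy =
    ⊖-closed isChainGroup Cx (IsChainGroup.C-smul isChainGroup (x e * v) Cy)

  ·-vanishesOff : ∀ {n} {x : Chain R n} {A} r → VanishesOff x A → VanishesOff (r · x) A
  ·-vanishesOff r x≈0 e∉A = trans (*-congˡ (x≈0 e∉A)) (zeroʳ r)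

  ⊖-vanishesOff : ∀ {n} {x y : Chain R n} {A B} →
                  VanishesOff x A → VanishesOff y B → VanishesOff (x ⊖ y) (A ∪ B)
  ⊖-vanishesOff {A = A} {B} x≈0 y≈0 e∉A∪B =
    x≈y⇒x∙y⁻¹≈ε (trans (x≈0 (λ e∈A → e∉A∪B (p⊆p∪q B e∈A)))
                       (sym (y≈0 (λ e∈B → e∉A∪B (q⊆p∪q A B e∈B)))))

  vanishesOff-remove : ∀ {n} {x : Chain R n} {A} f → VanishesOff x A → x f ≈ 0# →
                       VanishesOff x (A - f)
  vanishesOff-remove f x≈0 xf≈0 {e} e∉A-f with e ≟ᶠ f
  ... | yes refl = xf≈0
  ... | no e≢f   = x≈0 (λ e∈A → e∉A-f (x∈p∧x≢y⇒x∈p-y e∈A e≢f))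

  [x*v]*u≈x : ∀ {u v} x → v * u ≈ 1# → (x * v) * u ≈ x
  [x*v]*u≈x {u} {v} x vu≈1 = begin
    (x * v) * u  ≈⟨ *-assoc x v u ⟩
    x * (v * u)  ≈⟨ *-congˡ vu≈1 ⟩
    x * 1#       ≈⟨ *-identityʳ x ⟩
    x            ∎

  eliminate-pivot : ∀ {n} (x y : Chain R n) e {v} → v * y e ≈ 1# → eliminate x y e v e ≈ 0#
  eliminate-pivot x y e vy≈1 = x≈y⇒x∙y⁻¹≈ε (sym ([x*v]*u≈x (x e) vy≈1))

  eliminate-vanishesOff : ∀ {n} {x y : Chain R n} {A B} e {v} → v * y e ≈ 1# →
                          VanishesOff x A → VanishesOff y B →
                          VanishesOff (eliminate x y e v) ((A ∪ B) - e)
  eliminate-vanishesOff {x = x} {y} e vy≈1 x≈0 y≈0 =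
    vanishesOff-remove e (⊖-vanishesOff x≈0 (·-vanishesOff (x e * _) y≈0))
                       (eliminate-pivot x y e vy≈1)

  ≈⇒⊖≈0 : ∀ {n} (x y : Chain R n) e → x e ≈ y e → (x ⊖ y) e ≈ 0#
  ≈⇒⊖≈0 x y e = x≈y⇒x∙y⁻¹≈ε

  ⊖≈0⇒≈ : ∀ {n} (x y : Chain R n) e → (x ⊖ y) e ≈ 0# → x e ≈ y e
  ⊖≈0⇒≈ x y e = x∙y⁻¹≈ε⇒x≈y (x e) (y e)

  ⊖-vanishingʳ : ∀ {n} (x y : Chain R n) e → y e ≈ 0# → (x ⊖ y) e ≈ x e
  ⊖-vanishingʳ x y e ye≈0 = begin
    x e + - y e  ≈⟨ +-congˡ (trans (-‿cong ye≈0) ε⁻¹≈ε) ⟩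
    x e + 0#     ≈⟨ +-identityʳ (x e) ⟩
    x e          ∎

  x*u≈0⇒x≈0 : ∀ {x u} → IsUnit R u → x * u ≈ 0# → x ≈ 0#
  x*u≈0⇒x≈0 {x} {u} (v , uv≈1 , _) xu≈0 = begin
    x             ≈⟨ [x*v]*u≈x x uv≈1 ⟨
    (x * u) * v   ≈⟨ *-congʳ xu≈0 ⟩
    0# * v        ≈⟨ zeroˡ v ⟩
    0#            ∎

  unit≈0⇒1≈0 : ∀ {u} → IsUnit R u → u ≈ 0# → 1# ≈ 0#
  unit≈0⇒1≈0 {u} (v , uv≈1 , _) u≈0 = begin
    1#      ≈⟨ uv≈1 ⟨
    u * v   ≈⟨ *-congʳ u≈0 ⟩
    0# * v  ≈⟨ zeroˡ v ⟩
    0#      ∎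

module _ {c ℓ k : Level} {R : Ring c ℓ} {n : ℕ} {C : Chain R n → Set k} where
  open Ring R
  open ChainAlgebra R
  open import Relation.Binary.Reasoning.Setoid setoid

  elementary⇒1≉0 : ∀ {x} → Elementary R C x → ¬ (1# ≈ 0#)
  elementary⇒1≉0 {x} (_ , x≢0 , _) 1≈0 = x≢0 λ e → begin
    x e       ≈⟨ *-identityˡ (x e) ⟨
    1# * x e  ≈⟨ *-congʳ 1≈0 ⟩
    0# * x e  ≈⟨ zeroˡ (x e) ⟩
    0#        ∎

  -- Since ≈ need not be decidable, "d is zero" only comes out doubly negated.
  elementary-rigid : ∀ {x D d A} → Elementary R C x → SuppIs R x D →
                     C d → VanishesOff d A → A ⊂ D → ¬ NonZeroChain R d
  elementary-rigid {x} {d = d} (_ , _ , minimal) supp Cd d≈0 (A⊆D , f , f∈D , f∉A) d≢0 =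
    minimal d Cd d≢0
      (supp-d⊆supp-x , λ supp-x⊆supp-d → supp-x⊆supp-d f (proj₂ (supp f) f∈D) (d≈0 f∉A))
    where
    supp-d⊆supp-x : ∀ e → InSupp R d e → InSupp R x e
    supp-d⊆supp-x e de≉0 xe≈0 = de≉0 (d≈0 λ e∈A → proj₂ (supp e) (A⊆D e∈A) xe≈0)

record UnitChain {c ℓ k : Level} (R : Ring c ℓ) {n : ℕ} (C : Chain R n → Set k) (D : Subset n)
                 : Set (c ⊔ ℓ ⊔ k) where
  open Ring R
  field
    chain    : Chain R n
    member   : C chain
    unit-on  : ∀ {e} → e ∈ D → IsUnit R (chain e)
    vanishes : ChainAlgebra.VanishesOff R chain D

  inverse : ∀ {e} → e ∈ D → Carrier
  inverse e∈D = proj₁ (unit-on e∈D)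

  inverse-left : ∀ {e} (e∈D : e ∈ D) → inverse e∈D * chain e ≈ 1#
  inverse-left e∈D = proj₂ (proj₂ (unit-on e∈D))

module _ {c ℓ g k : Level} {R : Ring c ℓ} {G : Ring.Carrier R → Set g} {n : ℕ}
         {C : Chain R n → Set k} (spf : IsSkewPartialField R G) (pcg : IsPChainGroup R G C) where
  open Ring R
  open ChainAlgebra R
  open IsSkewPartialField spf
  open import Relation.Binary.Reasoning.Setoid setoid

  elementary⇒unitChain : ∀ {x D} → Elementary R C x → SuppIs R x D → UnitChain R C D
  elementary⇒unitChain {x} {D} el@(_ , x≢0 , _) supp with proj₂ pcg x el
  ... | r , x′ , Cx′ , x′-primitive , x≈rx′ = record
    { chain = x′ ; member = Cx′ ; unit-on = unit-on ; vanishes = vanishes }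
    where
    unit-on : ∀ {e} → e ∈ D → IsUnit R (x′ e)
    unit-on {e} e∈D with x′-primitive e
    ... | inj₁ x′e∈G = G-unit x′e∈G
    ... | inj₂ x′e≈0 =
      ⊥-elim (proj₂ (supp e) e∈D (trans (x≈rx′ e) (trans (*-congˡ x′e≈0) (zeroʳ r))))

    vanishes : VanishesOff x′ D
    vanishes {e} e∉D with x′-primitive e
    ... | inj₂ x′e≈0 = x′e≈0
    ... | inj₁ x′e∈G = ⊥-elim (e∉D (proj₁ (supp e) λ xe≈0 → x≢0 λ f → begin
      x f       ≈⟨ x≈rx′ f ⟩
      r * x′ f  ≈⟨ *-congʳ (x*u≈0⇒x≈0 (G-unit x′e∈G) (trans (sym (x≈rx′ e)) xe≈0)) ⟩
      0# * x′ f ≈⟨ zeroˡ (x′ f) ⟩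
      0#        ∎))

private
  I O : Side
  I = inside
  O = outside

-- Complements of the hyperplanes {5,6,7,8}, {3,4,5,6}, {1,2,5,6}, {3,4,7,8}, {1,2,7,8},
-- {1,3,5}, {1,3,7} and {2,3,4} of V₈ (element i of V₈ is index i - 1).
T W Y W′ Y′ Z Z′ Z″ : Subset 8
T  = ∁ c5678
W  = ∁ c3456
Y  = ∁ c1256
W′ = ∁ c3478
Y′ = ∁ c1278
Z  = O ∷ I ∷ O ∷ I ∷ O ∷ I ∷ I ∷ I ∷ []
Z′ = O ∷ I ∷ O ∷ I ∷ I ∷ I ∷ O ∷ I ∷ []
Z″ = I ∷ O ∷ O ∷ O ∷ I ∷ I ∷ I ∷ I ∷ []

T-cocircuit : VamosCocircuit T
T-cocircuit = vamosCocircuit T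

W-cocircuit : VamosCocircuit W
W-cocircuit = vamosCocircuit W

Y-cocircuit : VamosCocircuit Y
Y-cocircuit = vamosCocircuit Y

W′-cocircuit : VamosCocircuit W′
W′-cocircuit = vamosCocircuit W′

Y′-cocircuit : VamosCocircuit Y′
Y′-cocircuit = vamosCocircuit Y′

Z-cocircuit : VamosCocircuit Z
Z-cocircuit = vamosCocircuit Z

Z′-cocircuit : VamosCocircuit Z′
Z′-cocircuit = vamosCocircuit Z′

Z″-cocircuit : VamosCocircuit Z″
Z″-cocircuit = vamosCocircuit Z″

module VamosNotRepresentable
  {c ℓ g k : Level} {R : Ring c ℓ} {G : Ring.Carrier R → Set g} {C : Chain R 8 → Set k}
  (spf : IsSkewPartialField R G) (pcg : IsPChainGroup R G C) (mat : MatroidOfIs R C VamosCocircuit)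
  where
  open Ring R hiding (_-_)
  open ChainAlgebra R
  open UnitChain
  open import Relation.Binary.Reasoning.Setoid setoid

  isChainGroup : IsChainGroup R C
  isChainGroup = proj₁ pcg

  open IsChainGroup isChainGroup using (C-smul)

  elementaryOn : ∀ {D} → VamosCocircuit D → ∃ λ x → Elementary R C x × SuppIs R x D
  elementaryOn {D} = proj₂ mat D

  unitChain : ∀ {D} → VamosCocircuit D → UnitChain R C D
  unitChain cocircuit =
    let _ , el , supp = elementaryOn cocircuit in elementary⇒unitChain spf pcg el supp

  rigid : ∀ {D d A} → VamosCocircuit D → C d → VanishesOff d A → A ⊂ D → ¬ NonZeroChain R d
  rigid cocircuit = let _ , el , supp = elementaryOn cocircuit in elementary-rigid {R = R} el supp

  1≉0 : ¬ (1# ≈ 0#)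
  1≉0 = elementary⇒1≉0 {R = R} (proj₁ (proj₂ (elementaryOn T-cocircuit)))

  t : UnitChain R C T
  t = unitChain T-cocircuit

  t₀ t₁ : Carrier
  t₀ = chain t (# 0)
  t₁ = chain t (# 1)

  pivot : ∀ {D} → UnitChain R C D → # 0 ∈ D → Carrier
  pivot w 0∈D = t₀ * inverse w 0∈D

  pivot·w≈t₀ : ∀ {D} (w : UnitChain R C D) (0∈D : # 0 ∈ D) →
               (pivot w 0∈D · chain w) (# 0) ≈ t₀
  pivot·w≈t₀ w 0∈D = [x*v]*u≈x t₀ (inverse-left w 0∈D)

  t₁≈pivot·w₁ : ∀ {D E F} (w : UnitChain R C D) (y : UnitChain R C E)
                (0∈D : # 0 ∈ D) (2∈E : # 2 ∈ E) → # 1 ∉ E →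
                VamosCocircuit F → (((T ∪ D) - # 0) ∪ E) - # 2 ⊂ F →
                ¬ ¬ (t₁ ≈ (pivot w 0∈D · chain w) (# 1))
  t₁≈pivot·w₁ {D} {E} w y 0∈D 2∈E 1∉E cocircuit ⊂F t₁≉ =
    rigid cocircuit s-member s-vanishes ⊂F λ s≈0 →
      t₁≉ (⊖≈0⇒≈ (chain t) (pivot w 0∈D · chain w) (# 1) (trans (sym s₁≈a₁) (s≈0 (# 1))))
    where
    a s : Chain R 8
    a = eliminate (chain t) (chain w) (# 0) (inverse w 0∈D)
    s = eliminate a (chain y) (# 2) (inverse y 2∈E)

    s-member : C s
    s-member = eliminate-closed isChainGroup (# 2) _
                 (eliminate-closed isChainGroup (# 0) _ (member t) (member w)) (member y)

    s-vanishes : VanishesOff s ((((T ∪ D) - # 0) ∪ E) - # 2)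
    s-vanishes = eliminate-vanishesOff (# 2) (inverse-left y 2∈E)
                   (eliminate-vanishesOff (# 0) (inverse-left w 0∈D) (vanishes t) (vanishes w))
                   (vanishes y)

    s₁≈a₁ : s (# 1) ≈ a (# 1)
    s₁≈a₁ = ⊖-vanishingʳ a (μ · chain y) (# 1) (·-vanishesOff μ (vanishes y) 1∉E)
      where
      μ : Carrier
      μ = a (# 2) * inverse y 2∈E

  w : UnitChain R C W
  w = unitChain W-cocircuit

  y : UnitChain R C Y
  y = unitChain Y-cocircuit

  w′ : UnitChain R C W′
  w′ = unitChain W′-cocircuit

  y′ : UnitChain R C Y′
  y′ = unitChain Y′-cocircuit

  m m′ : Carrier
  m  = pivot w ∈!
  m′ = pivot w′ ∈!

  mw m′w′ q : Chain R 8
  mw   = m · chain w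
  m′w′ = m′ · chain w′
  q    = mw ⊖ m′w′

  q-member : C q
  q-member = ⊖-closed isChainGroup (C-smul m (member w)) (C-smul m′ (member w′))

  q-vanishes : t₁ ≈ mw (# 1) → t₁ ≈ m′w′ (# 1) → VanishesOff q (((W ∪ W′) - # 0) - # 1)
  q-vanishes t₁≈mw₁ t₁≈m′w′₁ =
    vanishesOff-remove (# 1) (vanishesOff-remove (# 0) q-vanishesOff-W∪W′ q₀≈0) q₁≈0
    where
    q-vanishesOff-W∪W′ : VanishesOff q (W ∪ W′)
    q-vanishesOff-W∪W′ = ⊖-vanishesOff (·-vanishesOff m (vanishes w)) (·-vanishesOff m′ (vanishes w′))

    q₀≈0 : q (# 0) ≈ 0#
    q₀≈0 = ≈⇒⊖≈0 mw m′w′ (# 0) (trans (pivot·w≈t₀ w ∈!) (sym (pivot·w≈t₀ w′ ∈!)))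

    q₁≈0 : q (# 1) ≈ 0#
    q₁≈0 = ≈⇒⊖≈0 mw m′w′ (# 1) (trans (sym t₁≈mw₁) t₁≈m′w′₁)

  t₀≈0 : q (# 6) ≈ 0# → t₀ ≈ 0#
  t₀≈0 q₆≈0 = begin
    t₀                 ≈⟨ pivot·w≈t₀ w ∈! ⟨
    m * chain w (# 0)  ≈⟨ *-congʳ m≈0 ⟩
    0# * chain w (# 0) ≈⟨ zeroˡ _ ⟩
    0#                 ∎
    where
    m≈0 : m ≈ 0#
    m≈0 = x*u≈0⇒x≈0 (unit-on w ∈!)
            (trans (⊖≈0⇒≈ mw m′w′ (# 6) q₆≈0) (·-vanishesOff m′ (vanishes w′) ∉!))

  contradiction : ⊥
  contradiction =
    t₁≈pivot·w₁ w y ∈! ∈! ∉! Z-cocircuit ⊂! λ t₁≈mw₁ →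
    t₁≈pivot·w₁ w′ y′ ∈! ∈! ∉! Z′-cocircuit ⊂! λ t₁≈m′w′₁ →
    rigid Z″-cocircuit q-member (q-vanishes t₁≈mw₁ t₁≈m′w′₁) ⊂! λ q≈0 →
    1≉0 (unit≈0⇒1≈0 (unit-on t ∈!) (t₀≈0 (q≈0 (# 6))))

theorem3p34 : ∀ {c ℓ g k : Level} (R : Ring c ℓ) (G : Ring.Carrier R → Set g)
              → IsSkewPartialField R G
              → (C : Chain R 8 → Set k)
              → IsPChainGroup R G C
              → ¬ MatroidOfIs R C VamosCocircuit
theorem3p34 R G spf C pcg mat = VamosNotRepresentable.contradiction spf pcg mat
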